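{- Let $\mathfrak{m}=(\pi,S)$ be a marked perfect matching with respect to $(n_1,\dots,n_k)$, and let $e_i,e_j$ be edges of $\pi$ with $i<j$ and $\pi(i)>\pi(j)$ (i.e. $e_i$ crosses $e_j$ from the left). Then $\mathrm{bdiff}_{\mathfrak{m}}(e_i)\ge\mathrm{bdiff}_{\mathfrak{m}}(e_j)$, and the inequality is strict if $e_i\in S$ or $e_j\in S$.
   Context: Fix positive integers $n_1,\dots,n_k$ and $N=n_1+\dots+n_k$. Let $\pi$ be a permutation of $[N]$, viewed as a perfect matching with edges $e_i=(i,\overline{\pi(i)})$, $i\in[N]$ ($i$ an upper vertex, $\overline{\pi(i)}$ a lower vertex). An edge $e_i$ is homogeneous if $n_1+\dots+n_{r-1}+1\le i,\pi(i)\le n_1+\dots+n_r$ for some $r\in[k]$, and inhomogeneous otherwise. A marked perfect matching is a pair $\mathfrak{m}=(\pi,S)$ with $S$ a set of edges of $\pi$ containing all inhomogeneous edges; edges in $S$ are called marked. The upper block index $\mathrm{bind}^U_{\mathfrak{m}}(i)$ is $1$ plus the number of $u<i$ with $e_u\in S$; the lower block index $\mathrm{bind}^L_{\mathfrak{m}}(j)$ is $1$ plus the number of $v<j$ such that the edge with lower endpoint $\bar v$ lies in $S$. The block difference of $e_i$ is $\mathrm{bdiff}_{\mathfrak{m}}(e_i)=\mathrm{bind}^L_{\mathfrak{m}}(\pi(i))-\mathrm{bind}^U_{\mathfrak{m}}(i)$. -}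

module Defs where

open import Data.Nat using (ℕ; zero; suc; _+_; _≤_; _<_)
open import Data.Nat.Properties using (_<?_)
open import Data.Fin using (Fin; toℕ)
open import Data.Fin.Subset using (Subset; _∈_; _∉_; ∣_∣)
open import Data.Vec using (tabulate; lookup; sum)
open import Relation.Nullary using (¬_; yes; no)
open import Data.Bool using (Bool; true; false; _∧_)
open import Data.Integer using (ℤ; +_; _-_)
open import Data.Product using (∃; _×_)
open import Relation.Nullary.Decidable using (⌊_⌋)
open import Data.Fin.Permutation using (Permutation′; _⟨$⟩ʳ_; _⟨$⟩ˡ_)

-- A composition (n₁,…,n_k) of positive integers: n : Fin k → ℕ (positivity assumed separately).
-- N = n₁ + … + n_k
total : {k : ℕ} → (Fin k → ℕ) → ℕ
total n = sum (tabulate n)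

-- prefix n r = n₁ + … + n_{r-1}  (r is 0-based, so this sums n over indices < r)
prefix : {k : ℕ} → (Fin k → ℕ) → Fin k → ℕ
prefix {k} n r = sum (tabulate if-lt)
  where
  if-lt : Fin k → ℕ
  if-lt s with toℕ s <? toℕ r
  ... | yes _ = n s
  ... | no _ = 0

-- Positions are 0-based: Fin N element p corresponds to vertex toℕ p + 1.
-- p lies in block r iff n₁+…+n_{r-1}+1 ≤ toℕ p + 1 ≤ n₁+…+n_r.
InBlock : {k : ℕ} → (n : Fin k → ℕ) → Fin k → ℕ → Set
InBlock n r p = prefix n r ≤ p × p < prefix n r + n r

Homogeneous : {k : ℕ} (n : Fin k → ℕ) → Permutation′ (total n) → Fin (total n) → Set
Homogeneous n π i = ∃ λ r → InBlock n r (toℕ i) × InBlock n r (toℕ (π ⟨$⟩ʳ i))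

-- A marked perfect matching: S ⊆ [N] is the set of upper indices i with e_i marked,
-- containing all inhomogeneous edges.
record MarkedMatching {k : ℕ} (n : Fin k → ℕ) : Set where
  field
    π : Permutation′ (total n)
    S : Subset (total n)
    inhom-marked : ∀ i → ¬ Homogeneous n π i → i ∈ S

countBelow : {N : ℕ} → (Fin N → Bool) → ℕ → ℕ
countBelow {N} P m = ∣ tabulate (λ u → ⌊ toℕ u <? m ⌋ ∧ P u) ∣

module _ {k : ℕ} {n : Fin k → ℕ} (𝔪 : MarkedMatching n) where
  open MarkedMatching 𝔪

  memb : Fin (total n) → Bool
  memb i = lookup S i

  bindU : Fin (total n) → ℕ
  bindU i = suc (countBelow memb (toℕ i))

  -- bind^L(j) = 1 + #{v < j : the edge with lower endpoint v, i.e. e_{π⁻¹(v)}, is in S}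
  bindL : Fin (total n) → ℕ
  bindL j = suc (countBelow (λ v → memb (π ⟨$⟩ˡ v)) (toℕ j))

  bdiff : Fin (total n) → ℤ
  bdiff i = + bindL (π ⟨$⟩ʳ i) - + bindU i

module Submission where

-- A block index counts the marked edges strictly to the left of a vertex, so it is monotone
-- along each row. For edges e_i, e_j with i < j and π(i) > π(j) this gives
-- bind^U(i) ≤ bind^U(j) and bind^L(π(j)) ≤ bind^L(π(i)), hence the weak inequality.
-- If e_i is marked it is counted in bind^U(j) but not in bind^U(i); if e_j is marked,
-- its lower endpoint π(j) is counted in bind^L(π(i)) but not in bind^L(π(j)).

open import Defs
open import Data.Nat using (ℕ; _<_; _>_; _≥_; _≤_; s≤s)
open import Data.Nat.Properties using (_<?_; ≤-refl; <-≤-trans; ≤-<-trans; <⇒≤; <⇒≱)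
open import Data.Fin using (Fin; toℕ)
open import Data.Fin.Subset using (Subset; _∈_; _⊆_; _⊂_)
open import Data.Fin.Subset.Properties using (p⊆q⇒∣p∣≤∣q∣; p⊂q⇒∣p∣<∣q∣)
open import Data.Fin.Permutation using (_⟨$⟩ʳ_; _⟨$⟩ˡ_; inverseˡ)
open import Data.Vec using (tabulate)
open import Data.Vec.Properties using (lookup∘tabulate; []=⇒lookup; lookup⇒[]=)
open import Data.Bool using (Bool; true; _∧_)
open import Data.Bool.Properties using (T-≡; T-∧)
open import Data.Sum using (_⊎_; inj₁; inj₂)
open import Data.Product using (_×_; _,_; proj₁)
open import Function.Bundles using (_⇔_; mk⇔; Equivalence)
open import Relation.Nullary.Decidable using (⌊_⌋; toWitness; fromWitness)
open import Relation.Binary.PropositionalEquality using (_≡_; trans; sym; subst)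
open import Data.Integer as ℤ using (ℤ; _-_; +≤+; +<+)
open import Data.Integer.Properties using (+-mono-≤; +-mono-≤-<; +-mono-<-≤; neg-mono-≤; neg-mono-<)

open Equivalence using (to; from)

-mono-≤ : {a a′ b b′ : ℤ} → a ℤ.≤ a′ → b′ ℤ.≤ b → a - b ℤ.≤ a′ - b′
-mono-≤ a≤a′ b′≤b = +-mono-≤ a≤a′ (neg-mono-≤ b′≤b)

-mono-≤-< : {a a′ b b′ : ℤ} → a ℤ.≤ a′ → b′ ℤ.< b → a - b ℤ.< a′ - b′
-mono-≤-< a≤a′ b′<b = +-mono-≤-< a≤a′ (neg-mono-< b′<b)

-mono-<-≤ : {a a′ b b′ : ℤ} → a ℤ.< a′ → b′ ℤ.≤ b → a - b ℤ.< a′ - b′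
-mono-<-≤ a<a′ b′≤b = +-mono-<-≤ a<a′ (neg-mono-≤ b′≤b)

module _ {N : ℕ} where

  -- countBelow P m is definitionally ∣ below P m ∣.
  below : (Fin N → Bool) → ℕ → Subset N
  below P m = tabulate (λ u → ⌊ toℕ u <? m ⌋ ∧ P u)

  ∈-below : {P : Fin N → Bool} {m : ℕ} {x : Fin N} →
            x ∈ below P m ⇔ (toℕ x < m × P x ≡ true)
  ∈-below {P} {m} {x} = mk⇔ from-∈ to-∈
    where
    f : Fin N → Bool
    f u = ⌊ toℕ u <? m ⌋ ∧ P u

    from-∈ : x ∈ below P m → toℕ x < m × P x ≡ true
    from-∈ x∈ with to T-∧ (from T-≡ (trans (sym (lookup∘tabulate f x)) ([]=⇒lookup x∈)))
    ... | x<m , Px = toWitness x<m , to T-≡ Px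

    to-∈ : toℕ x < m × P x ≡ true → x ∈ below P m
    to-∈ (x<m , Px) =
      lookup⇒[]= x _ (trans (lookup∘tabulate f x) (to T-≡ (from T-∧ (fromWitness x<m , from T-≡ Px))))

  below-mono : {P : Fin N → Bool} {m m′ : ℕ} → m ≤ m′ → below P m ⊆ below P m′
  below-mono m≤m′ x∈ with to ∈-below x∈
  ... | x<m , Px = from ∈-below (<-≤-trans x<m m≤m′ , Px)

  below-⊂ : {P : Fin N → Bool} {m m′ : ℕ} (x : Fin N) →
            P x ≡ true → m ≤ toℕ x → toℕ x < m′ → below P m ⊂ below P m′
  below-⊂ x Px m≤x x<m′ =
    below-mono (<⇒≤ (≤-<-trans m≤x x<m′)) , x , from ∈-below (x<m′ , Px) ,
    λ x∈ → <⇒≱ (proj₁ (to ∈-below x∈)) m≤x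

  countBelow-mono : (P : Fin N → Bool) {m m′ : ℕ} → m ≤ m′ → countBelow P m ≤ countBelow P m′
  countBelow-mono P m≤m′ = p⊆q⇒∣p∣≤∣q∣ (below-mono m≤m′)

  countBelow-strict : (P : Fin N → Bool) {m m′ : ℕ} (x : Fin N) →
                      P x ≡ true → m ≤ toℕ x → toℕ x < m′ → countBelow P m < countBelow P m′
  countBelow-strict P x Px m≤x x<m′ = p⊂q⇒∣p∣<∣q∣ (below-⊂ x Px m≤x x<m′)

module _ {k : ℕ} {n : Fin k → ℕ} (𝔪 : MarkedMatching n) where
  open MarkedMatching 𝔪

  bindU-mono : {i j : Fin (total n)} → toℕ i ≤ toℕ j → bindU 𝔪 i ≤ bindU 𝔪 j
  bindU-mono i≤j = s≤s (countBelow-mono (memb 𝔪) i≤j)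

  bindU-strict : {i j : Fin (total n)} → i ∈ S → toℕ i < toℕ j → bindU 𝔪 i < bindU 𝔪 j
  bindU-strict {i} i∈S i<j = s≤s (countBelow-strict (memb 𝔪) i ([]=⇒lookup i∈S) ≤-refl i<j)

  bindL-mono : {a b : Fin (total n)} → toℕ a ≤ toℕ b → bindL 𝔪 a ≤ bindL 𝔪 b
  bindL-mono a≤b = s≤s (countBelow-mono (λ v → memb 𝔪 (π ⟨$⟩ˡ v)) a≤b)

  bindL-strict : {a b : Fin (total n)} → π ⟨$⟩ˡ a ∈ S → toℕ a < toℕ b → bindL 𝔪 a < bindL 𝔪 b
  bindL-strict {a} ea∈S a<b = s≤s (countBelow-strict (λ v → memb 𝔪 (π ⟨$⟩ˡ v)) a ([]=⇒lookup ea∈S) ≤-refl a<b)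

proposition4p1 : {k : ℕ} (n : Fin k → ℕ) → (∀ r → n r ≥ 1) →
    (𝔪 : MarkedMatching n) → (i j : Fin (total n)) →
    toℕ i < toℕ j →
    toℕ (MarkedMatching.π 𝔪 ⟨$⟩ʳ i) > toℕ (MarkedMatching.π 𝔪 ⟨$⟩ʳ j) →
    (bdiff 𝔪 i ℤ.≥ bdiff 𝔪 j) ×
    (i ∈ MarkedMatching.S 𝔪 ⊎ j ∈ MarkedMatching.S 𝔪 → bdiff 𝔪 i ℤ.> bdiff 𝔪 j)
proposition4p1 n _ 𝔪 i j i<j πj<πi = -mono-≤ bindL≤ bindU≤ , strict
  where
  open MarkedMatching 𝔪

  bindL≤ : ℤ.+ bindL 𝔪 (π ⟨$⟩ʳ j) ℤ.≤ ℤ.+ bindL 𝔪 (π ⟨$⟩ʳ i)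
  bindL≤ = +≤+ (bindL-mono 𝔪 (<⇒≤ πj<πi))

  bindU≤ : ℤ.+ bindU 𝔪 i ℤ.≤ ℤ.+ bindU 𝔪 j
  bindU≤ = +≤+ (bindU-mono 𝔪 (<⇒≤ i<j))

  strict : i ∈ S ⊎ j ∈ S → bdiff 𝔪 i ℤ.> bdiff 𝔪 j
  strict (inj₁ i∈S) = -mono-≤-< bindL≤ (+<+ (bindU-strict 𝔪 i∈S i<j))
  strict (inj₂ j∈S) =
    -mono-<-≤ (+<+ (bindL-strict 𝔪 (subst (_∈ S) (sym (inverseˡ π)) j∈S) πj<πi)) bindU≤
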